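{- Let $F$ be an irredundant finite family of intervals and $g$ an interval such that $F\cup\{g\}$ is redundant. Then there is an interval $f\in F$ with $f\ne g$ such that $(F\cup\{g\})\setminus\{f\}$ is irredundant.
   Context: For integers $a<b$, $[a,b)$ denotes $\{x\in\mathbb{Z}: a\le x<b\}$; an interval is a (nonempty) set of this form. A family of sets is irredundant if its members can be arranged in a sequence such that each set contains a point not in any of the preceding sets; it is redundant otherwise. -}

module Defs where

open import Data.Integer using (ℤ; _≤_; _<_)
open import Data.Integer.Properties using (_≟_)
open import Data.Product using (Σ; _×_; _,_; proj₁; proj₂; ∃)
open import Data.Product.Properties using (≡-dec)
open import Data.List using (List; []; _∷_; length; lookup; filter)
open import Data.List.Membership.DecPropositional using ()
open import Data.Fin using (Fin; toℕ)
import Data.Nat as ℕ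
open import Data.List.Relation.Binary.Permutation.Propositional using (_↭_)
open import Relation.Nullary using (¬_; Dec; yes; no)
open import Relation.Nullary.Decidable using (¬?)
open import Relation.Binary.PropositionalEquality using (_≡_)
open import Relation.Binary.Definitions using (DecidableEquality)

-- An interval [a,b) = {x ∈ ℤ : a ≤ x < b} is represented by its endpoint
-- pair (a , b); it is a (nonempty) interval when a < b.  For a < b the pair
-- is uniquely determined by the set, so equality of intervals is equality
-- of endpoint pairs.
Interval : Set
Interval = ℤ × ℤ

IsInterval : Interval → Set
IsInterval (a , b) = a < b

_∈I_ : ℤ → Interval → Set
x ∈I (a , b) = (a ≤ x) × (x < b)

_≟I_ : DecidableEquality Interval
_≟I_ = ≡-dec _≟_ _≟_

open import Data.List.Membership.DecPropositional _≟I_ public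
  using (_∈_; _∉_; _∈?_)

-- A finite family of intervals is a duplicate-free list (see Unique in the
-- statement).  Set-theoretic union with a single interval:
insertI : Interval → List Interval → List Interval
insertI g F with g ∈? F
... | yes _ = F
... | no  _ = g ∷ F

removeI : Interval → List Interval → List Interval
removeI f F = filter (λ h → ¬? (h ≟I f)) F

IrredundantSeq : List Interval → Set
IrredundantSeq σ =
  (i : Fin (length σ)) → ∃ λ x → (x ∈I lookup σ i) ×
    ((j : Fin (length σ)) → toℕ j ℕ.< toℕ i → ¬ (x ∈I lookup σ j))

Irredundant : List Interval → Set
Irredundant F = ∃ λ σ → (σ ↭ F) × IrredundantSeq σ

Redundant : List Interval → Set
Redundant F = ¬ Irredundant F

-- Let σ be an irredundant ordering of F, each member h carrying a witness
-- point that lies in h but in no earlier member.  Look for the last member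
-- of σ whose witness lies in g.  If there is none, g followed by σ is an
-- irredundant ordering of F ∪ {g} (g is nonempty, so it has a witness),
-- contradicting redundancy.  Otherwise replace that member h by g: g
-- inherits h's witness, the later members keep theirs, which avoid g by the
-- choice of h.  The interval structure enters only through g ≠ ∅.
module Submission where

open import Defs
open import Data.List using (List; []; _∷_; _++_; length; lookup)
open import Data.List.Properties using (filter-accept; filter-reject; filter-all)
open import Data.List.Relation.Unary.All as All using (All; []; _∷_)
open import Data.List.Relation.Unary.AllPairs using (_∷_)
open import Data.List.Relation.Unary.Any using (here)
open import Data.List.Relation.Unary.Unique.Propositional using (Unique)
open import Data.List.Relation.Binary.Subset.Propositional using (_⊆_)
open import Data.List.Relation.Binary.Subset.Propositional.Properties
  using (⊆-reflexive-↭; xs⊆x∷xs; ∷⁺ʳ)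
open import Data.List.Relation.Binary.Permutation.Propositional
  using (_↭_; prep; swap; ↭-refl; ↭-sym; ↭⇒↭ₛ; module PermutationReasoning)
open import Data.List.Relation.Binary.Permutation.Propositional.Properties
  using (∈-resp-↭; filter-↭; shift)
import Data.List.Relation.Binary.Permutation.Setoid.Properties as ↭ₛ
open import Data.List.Membership.Propositional.Properties using (∈-++⁺ʳ)
open import Data.Fin using (Fin; zero; suc; toℕ)
open import Data.Nat using (z≤n; s≤s)
import Data.Nat as ℕ
open import Data.Integer using (ℤ)
open import Data.Integer.Properties using (_≤?_; _<?_; ≤-refl)
open import Data.Product using (Σ; ∃; _×_; _,_)
open import Data.Empty using (⊥-elim)
open import Function using (_∘_; id)
open import Relation.Nullary using (¬_; Dec; yes; no)
open import Relation.Nullary.Decidable using (_×-dec_; ¬?)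
open import Relation.Binary.PropositionalEquality
  using (_≡_; _≢_; refl; sym; cong; setoid; module ≡-Reasoning)

_∈I?_ : (x : ℤ) (h : Interval) → Dec (x ∈I h)
x ∈I? (a , b) = (a ≤? x) ×-dec (x <? b)

_≢I?_ : (x h : Interval) → Dec (x ≢ h)
x ≢I? h = ¬? (x ≟I h)

Avoids : ℤ → List Interval → Set
Avoids x P = All (λ h → ¬ (x ∈I h)) P

-- IrredundantAfter P σ: σ is an irredundant sequence continuing the
-- sequence P, which is kept in reverse order.
data IrredundantAfter (P : List Interval) : List Interval → Set where
  []  : IrredundantAfter P []
  _∷_ : ∀ {h σ} → (∃ λ x → (x ∈I h) × Avoids x P) →
        IrredundantAfter (h ∷ P) σ → IrredundantAfter P (h ∷ σ)

IrredundantSeqAfter : List Interval → List Interval → Set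
IrredundantSeqAfter P σ =
  (i : Fin (length σ)) → ∃ λ x → (x ∈I lookup σ i) × Avoids x P ×
    ((j : Fin (length σ)) → toℕ j ℕ.< toℕ i → ¬ (x ∈I lookup σ j))

seqAfter⇒after : ∀ {P} σ → IrredundantSeqAfter P σ → IrredundantAfter P σ
seqAfter⇒after []      _   = []
seqAfter⇒after {P} (h ∷ σ) seq with seq zero
... | x , x∈h , x∉P , _ = (x , x∈h , x∉P) ∷ seqAfter⇒after σ tail
  where
  tail : IrredundantSeqAfter (h ∷ P) σ
  tail i with seq (suc i)
  ... | y , y∈σᵢ , y∉P , y∉σ<ᵢ =
    y , y∈σᵢ , y∉σ<ᵢ zero (s≤s z≤n) ∷ y∉P , λ j j<i → y∉σ<ᵢ (suc j) (s≤s j<i)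

after⇒seqAfter : ∀ {P σ} → IrredundantAfter P σ → IrredundantSeqAfter P σ
after⇒seqAfter ((x , x∈h , x∉P) ∷ _) zero = x , x∈h , x∉P , λ _ ()
after⇒seqAfter (_ ∷ irr) (suc i) with after⇒seqAfter irr i
... | y , y∈σᵢ , y∉h ∷ y∉P , y∉σ<ᵢ =
  y , y∈σᵢ , y∉P , λ { zero _ → y∉h ; (suc j) (s≤s j<i) → y∉σ<ᵢ j j<i }

seq⇒after : ∀ {σ} → IrredundantSeq σ → IrredundantAfter [] σ
seq⇒after {σ} seq =
  seqAfter⇒after σ λ i → let x , x∈σᵢ , x∉σ<ᵢ = seq i in x , x∈σᵢ , [] , x∉σ<ᵢ

after⇒seq : ∀ {σ} → IrredundantAfter [] σ → IrredundantSeq σ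
after⇒seq irr i = let x , x∈σᵢ , _ , x∉σ<ᵢ = after⇒seqAfter irr i in x , x∈σᵢ , x∉σ<ᵢ

irredundantAfter-anti-mono : ∀ {P Q σ} → Q ⊆ P → IrredundantAfter P σ → IrredundantAfter Q σ
irredundantAfter-anti-mono Q⊆P [] = []
irredundantAfter-anti-mono Q⊆P ((x , x∈h , x∉P) ∷ irr) =
  (x , x∈h , All.tabulate (All.lookup x∉P ∘ Q⊆P)) ∷
  irredundantAfter-anti-mono (∷⁺ʳ _ Q⊆P) irr

data Exchange (g : Interval) (P : List Interval) : List Interval → Set where
  avoiding  : ∀ {σ} → IrredundantAfter (g ∷ P) σ → Exchange g P σ
  replacing : ∀ A h B → IrredundantAfter P (A ++ g ∷ B) → Exchange g P (A ++ h ∷ B)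

exchange : ∀ g {P} σ → IrredundantAfter P σ → Exchange g P σ
exchange g []      []  = avoiding []
exchange g (h ∷ σ) (w@(x , x∈h , x∉P) ∷ irr) with exchange g σ irr
... | replacing A h′ B irr′ = replacing (h ∷ A) h′ B (w ∷ irr′)
... | avoiding irr′ with x ∈I? g
...   | no  x∉g = avoiding ((x , x∈h , x∉g ∷ x∉P) ∷
    irredundantAfter-anti-mono (⊆-reflexive-↭ (swap h g ↭-refl)) irr′)
...   | yes x∈g = replacing [] h σ ((x , x∈g , x∉P) ∷
    irredundantAfter-anti-mono (∷⁺ʳ g (xs⊆x∷xs _ h)) irr′)

Unique-resp-↭ : ∀ {xs ys : List Interval} → xs ↭ ys → Unique xs → Unique ys
Unique-resp-↭ xs↭ys =
  ↭ₛ.AllPairs-resp-↭ (setoid Interval) (_∘ sym) ((λ { refl → id }) , (λ { refl → id }))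
    (↭⇒↭ₛ xs↭ys)

removeI-middle : ∀ A h B → Unique (A ++ h ∷ B) → removeI h (A ++ h ∷ B) ≡ A ++ B
removeI-middle [] h B (h∉B ∷ _) = begin
  removeI h (h ∷ B) ≡⟨ filter-reject (_≢I? h) (λ h≢h → h≢h refl) ⟩
  removeI h B       ≡⟨ filter-all (_≢I? h) (All.map (_∘ sym) h∉B) ⟩
  B                 ∎
  where open ≡-Reasoning
removeI-middle (a ∷ A) h B (a≢A++h∷B ∷ uniq) = begin
  removeI h (a ∷ A ++ h ∷ B) ≡⟨ filter-accept (_≢I? h) a≢h ⟩
  a ∷ removeI h (A ++ h ∷ B) ≡⟨ cong (a ∷_) (removeI-middle A h B uniq) ⟩
  a ∷ A ++ B                 ∎
  where
  open ≡-Reasoning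
  a≢h : a ≢ h
  a≢h = All.lookup a≢A++h∷B (∈-++⁺ʳ A (here refl))

replacing-↭ : ∀ {F} A h g B → h ≢ g → Unique F → A ++ h ∷ B ↭ F →
              A ++ g ∷ B ↭ removeI h (g ∷ F)
replacing-↭ {F} A h g B h≢g uniq σ↭F = begin
  A ++ g ∷ B                  ↭⟨ shift g A B ⟩
  g ∷ A ++ B                  ≡⟨ cong (g ∷_) (removeI-middle A h B uniqσ) ⟨
  g ∷ removeI h (A ++ h ∷ B)  ↭⟨ prep g (filter-↭ (_≢I? h) σ↭F) ⟩
  g ∷ removeI h F             ≡⟨ filter-accept (_≢I? h) (h≢g ∘ sym) ⟨
  removeI h (g ∷ F)           ∎
  where
  open PermutationReasoning
  uniqσ : Unique (A ++ h ∷ B)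
  uniqσ = Unique-resp-↭ (↭-sym σ↭F) uniq

mainTheorem3 : (F : List Interval) → Unique F → All IsInterval F →
    (g : Interval) → IsInterval g →
    Irredundant F → Redundant (insertI g F) →
    Σ Interval (λ f → (f ∈ F) × (¬ (f ≡ g)) × Irredundant (removeI f (insertI g F)))
mainTheorem3 F uniq _ g@(a , _) a<b irrF@(σ , σ↭F , irrσ) red with g ∈? F
... | yes _   = ⊥-elim (red irrF)
... | no  g∉F with exchange g σ (seq⇒after irrσ)
...   | avoiding irr′ =
  ⊥-elim (red (g ∷ σ , prep g σ↭F , after⇒seq ((a , (≤-refl , a<b) , []) ∷ irr′)))
...   | replacing A h B irr′ =
  h , h∈F , h≢g , A ++ g ∷ B , replacing-↭ A h g B h≢g uniq σ↭F , after⇒seq irr′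
  where
  h∈F : h ∈ F
  h∈F = ∈-resp-↭ σ↭F (∈-++⁺ʳ A (here refl))
  h≢g : h ≢ g
  h≢g refl = g∉F h∈F
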